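{- If a tree with back edges $(A,\Omega)$ has a $q$-witness, then the co-domain of its priority assignment $\Omega$ has at least $q$ elements.
   Context: A tree with back edges $(A,\Omega)$ is a finite tree with additional back edges (from a node to one of its ancestors), each node being modal (decorated with a set of literals) or disjunctive, together with a priority map $\Omega$ from nodes into a finite initial segment $\{0,\dots,q\}$ of $\mathbb{N}$; an infinite path has the parity of the highest priority seen infinitely often on it. A cycle has the parity of the maximal priority on it (the parity of the infinite path going around it forever). A $q$-witness consists of $q$ cycles $c_1,\dots,c_q$ such that each $c_i$ has the parity of $i$, and $c_i$ is a subcycle of $c_{i+1}$ for all $0<i<q$. -}

module Defs where

open import Data.Nat using (ℕ; zero; suc; _≤_; _<_; _⊔_; _%_)
open import Data.Fin using (Fin; zero; suc; toℕ; fromℕ<)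
open import Data.List using (List; []; _∷_; map; foldr)
open import Data.List.Membership.Propositional using (_∈_)
open import Data.List.Relation.Unary.Unique.Propositional using (Unique)
open import Data.Sum using (_⊎_)
open import Data.Empty using (⊥)
open import Data.Product using (Σ)
open import Relation.Binary.PropositionalEquality using (_≡_)

data NodeKind (Lit : Set) : Set where
  modal       : List Lit → NodeKind Lit
  disjunctive : NodeKind Lit

-- A finite rooted tree on the nodes Fin (suc n); the root is 'zero'.
-- Every non-root node 'suc i' has a parent with a smaller index
-- (every finite tree admits such a numbering, e.g. breadth-first).
record Tree (n : ℕ) : Set where
  field
    parent  : Fin n → Fin (suc n)
    parent< : (i : Fin n) → toℕ (parent i) < suc (toℕ i)

IsParent : ∀ {n} → Tree n → Fin (suc n) → Fin (suc n) → Set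
IsParent {n} T u zero    = ⊥
IsParent {n} T u (suc i) = Tree.parent T i ≡ u

data Ancestor {n} (T : Tree n) : Fin (suc n) → Fin (suc n) → Set where
  self : ∀ {v} → Ancestor T v v
  up   : ∀ {a u v} → Ancestor T a u → IsParent T u v → Ancestor T a v

record TreeWithBackEdges (Lit : Set) (n p : ℕ) : Set₁ where
  field
    tree   : Tree n
    kind   : Fin (suc n) → NodeKind Lit
    Back   : Fin (suc n) → Fin (suc n) → Set
    backOk : ∀ {u v} → Back u v → Ancestor tree v u
    Ω      : Fin (suc n) → Fin (suc p)

module _ {Lit : Set} {n p : ℕ} (A : TreeWithBackEdges Lit n p) where
  open TreeWithBackEdges A

  Edge : Fin (suc n) → Fin (suc n) → Set
  Edge u w = IsParent tree u w ⊎ Back u w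

  data Walk : Fin (suc n) → Fin (suc n) → Set where
    []  : ∀ {v} → Walk v v
    _∷_ : ∀ {u w v} → Edge u w → Walk w v → Walk u v

  -- nodes visited, excluding the final one
  walkNodes : ∀ {u v} → Walk u v → List (Fin (suc n))
  walkNodes []                = []
  walkNodes (_∷_ {u} e w)     = u ∷ walkNodes w

  record Cycle : Set where
    constructor cycle
    field
      start  : Fin (suc n)
      next   : Fin (suc n)
      first  : Edge start next
      rest   : Walk next start
      simple : Unique (start ∷ walkNodes rest)

  cycleNodes : Cycle → List (Fin (suc n))
  cycleNodes c = Cycle.start c ∷ walkNodes (Cycle.rest c)

  maxPrio : Cycle → ℕ
  maxPrio c = foldr _⊔_ 0 (map (λ v → toℕ (Ω v)) (cycleNodes c))

  HasParity : Cycle → ℕ → Set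
  HasParity c i = maxPrio c % 2 ≡ i % 2

  Subcycle : Cycle → Cycle → Set
  Subcycle c d = ∀ {v} → v ∈ cycleNodes c → v ∈ cycleNodes d

  -- A q-witness: cycles c₁,…,cq (c (k) stands for c_{k+1}) with c_i of the
  -- parity of i and c_i a subcycle of c_{i+1} for 0 < i < q.
  record Witness (q : ℕ) : Set where
    field
      c      : Fin q → Cycle
      parity : (k : Fin q) → HasParity (c k) (suc (toℕ k))
      nested : (k : Fin q) (h : suc (toℕ k) < q) → Subcycle (c k) (c (fromℕ< h))

-- Along the nested cycles of a witness the maximal priority can only grow
-- (a subcycle sees fewer nodes), and consecutive cycles have different
-- parities, so it grows strictly: the cycle c_i has maximal priority at
-- least i - 1.  Hence q - 1 ≤ p.
module Submission where

open import Defs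
open import Data.Nat using (ℕ; zero; suc; _≤_; _<_; _⊔_; _%_; z≤n; s≤s)
open import Data.Nat.Properties
  using (≤-refl; ≤-trans; <-trans; ≤-pred; n<1+n; ≤∧≢⇒<; ⊔-lub; m⊔n≤o⇒m≤o; m⊔n≤o⇒n≤o; +-comm; module ≤-Reasoning)
open import Data.Nat.DivMod using ([m+n]%n≡m%n)
open import Data.Fin using (Fin; toℕ; fromℕ<)
open import Data.Fin.Properties using (toℕ<n; toℕ-fromℕ<; fromℕ<-cong)
open import Data.List using (foldr)
open import Data.List.Properties using (foldr-preservesᵇ; foldr-forcesᵇ)
open import Data.List.Relation.Unary.All as All using (All)
open import Data.List.Relation.Unary.All.Properties as All using ()
open import Data.List.Relation.Binary.Subset.Propositional using (_⊆_)
open import Data.List.Relation.Binary.Subset.Propositional.Properties as ⊆ using ()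
open import Data.Product using (_,_)
open import Function using (_∘_)
open import Relation.Binary.PropositionalEquality
  using (_≡_; _≢_; sym; trans; cong; subst; module ≡-Reasoning)

foldr-⊔-lub : ∀ {xs b} → All (_≤ b) xs → foldr _⊔_ 0 xs ≤ b
foldr-⊔-lub = foldr-preservesᵇ ⊔-lub z≤n

foldr-⊔-ub : ∀ xs → All (_≤ foldr _⊔_ 0 xs) xs
foldr-⊔-ub xs = foldr-forcesᵇ (λ m n m⊔n≤o → m⊔n≤o⇒m≤o m n m⊔n≤o , m⊔n≤o⇒n≤o m n m⊔n≤o) _ xs ≤-refl

foldr-⊔-mono-⊆ : ∀ {xs ys} → xs ⊆ ys → foldr _⊔_ 0 xs ≤ foldr _⊔_ 0 ys
foldr-⊔-mono-⊆ {ys = ys} xs⊆ys = foldr-⊔-lub (All.tabulate (All.lookup (foldr-⊔-ub ys) ∘ xs⊆ys))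

[2+n]%2≡n%2 : ∀ n → suc (suc n) % 2 ≡ n % 2
[2+n]%2≡n%2 n = trans (cong (_% 2) (+-comm 2 n)) ([m+n]%n≡m%n n 2)

n%2≢[1+n]%2 : ∀ n → n % 2 ≢ suc n % 2
n%2≢[1+n]%2 zero    ()
n%2≢[1+n]%2 (suc n) eq = n%2≢[1+n]%2 n (sym (trans eq ([2+n]%2≡n%2 n)))

StrictlyIncreasing : ∀ {q} → (Fin q → ℕ) → Set
StrictlyIncreasing {q} f = ∀ k (h : suc (toℕ k) < q) → f k < f (fromℕ< h)

strictlyIncreasing⇒j≤f[j] : ∀ {q} (f : Fin q → ℕ) → StrictlyIncreasing f →
                            ∀ j (j<q : j < q) → j ≤ f (fromℕ< j<q)
strictlyIncreasing⇒j≤f[j]     f inc zero    _     = z≤n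
strictlyIncreasing⇒j≤f[j] {q} f inc (suc j) 1+j<q = begin-strict
  j                   ≤⟨ strictlyIncreasing⇒j≤f[j] f inc j j<q ⟩
  f k                 <⟨ inc k 1+k<q ⟩
  f (fromℕ< 1+k<q)    ≡⟨ cong f (fromℕ<-cong _ _ (cong suc (toℕ-fromℕ< j<q)) 1+k<q 1+j<q) ⟩
  f (fromℕ< 1+j<q)    ∎
  where
  open ≤-Reasoning
  j<q : j < q
  j<q = <-trans (n<1+n j) 1+j<q
  k : Fin q
  k = fromℕ< j<q
  1+k<q : suc (toℕ k) < q
  1+k<q = subst (λ i → suc i < q) (sym (toℕ-fromℕ< j<q)) 1+j<q

module _ {Lit : Set} {n p : ℕ} (A : TreeWithBackEdges Lit n p) where
  open TreeWithBackEdges A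

  maxPrio≤p : (c : Cycle A) → maxPrio A c ≤ p
  maxPrio≤p c = foldr-⊔-lub (All.map⁺ (All.universal (λ v → ≤-pred (toℕ<n (Ω v))) (cycleNodes A c)))

  maxPrio-mono : ∀ {c d} → Subcycle A c d → maxPrio A c ≤ maxPrio A d
  maxPrio-mono c⊆d = foldr-⊔-mono-⊆ (⊆.map⁺ (toℕ ∘ Ω) c⊆d)

  witness-maxPrio-increasing : ∀ {q} (W : Witness A q) → StrictlyIncreasing (maxPrio A ∘ Witness.c W)
  witness-maxPrio-increasing W k h = ≤∧≢⇒< (maxPrio-mono {c k} {c (fromℕ< h)} (nested k h)) maxPrio≢
    where
    open Witness W
    open ≡-Reasoning
    maxPrio≢ : maxPrio A (c k) ≢ maxPrio A (c (fromℕ< h))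
    maxPrio≢ eq = n%2≢[1+n]%2 (suc (toℕ k)) (begin
      suc (toℕ k) % 2               ≡⟨ sym (parity k) ⟩
      maxPrio A (c k) % 2           ≡⟨ cong (_% 2) eq ⟩
      maxPrio A (c (fromℕ< h)) % 2  ≡⟨ parity (fromℕ< h) ⟩
      suc (toℕ (fromℕ< h)) % 2      ≡⟨ cong (λ i → suc i % 2) (toℕ-fromℕ< h) ⟩
      suc (suc (toℕ k)) % 2         ∎)

lemma1 : {Lit : Set} {n p : ℕ} (A : TreeWithBackEdges Lit n p) (q : ℕ) →
         Witness A q → q ≤ suc p
lemma1 A zero    W = z≤n
lemma1 A (suc q) W = s≤s (≤-trans q≤maxPrio (maxPrio≤p A (Witness.c W last)))
  where
  last : Fin (suc q)
  last = fromℕ< (n<1+n q)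
  q≤maxPrio : q ≤ maxPrio A (Witness.c W last)
  q≤maxPrio = strictlyIncreasing⇒j≤f[j] _ (witness-maxPrio-increasing A W) q (n<1+n q)
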